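{- Let $p,p'$ be coprime integers with $1\le p<p'$ and let $1\le a<p'$. Then $\lfloor a(p'-p)/p'\rfloor=a-1-\lfloor ap/p'\rfloor$. If, in addition, $a$ is interfacial in the $(p,p')$-model and $e\in\{0,1\}$ satisfies $\delta^{p,p'}_{a,e}=0$, then $a$ is interfacial in the $(p'-p,p')$-model and $\delta^{p'-p,p'}_{a,1-e}=0$.
   Context: For coprime positive integers $q<q'$: for $2\le a\le q'-2$, $a$ is interfacial in the $(q,q')$-model if $\lfloor (a+1)q/q'\rfloor=\lfloor (a-1)q/q'\rfloor+1$; moreover $0$ and $q'$ are always interfacial and $1$ and $q'-1$ are never interfacial. For $e\in\{0,1\}$ and an integer $a$, $\delta^{q,q'}_{a,e}=0$ if $\lfloor (a+(-1)^e)q/q'\rfloor=\lfloor aq/q'\rfloor$ and $\delta^{q,q'}_{a,e}=1$ otherwise. -}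

module Defs where

open import Data.Nat using (ℕ; zero; suc; _+_; _*_; _∸_; _≤_; NonZero)
open import Data.Nat.DivMod using (_/_)
open import Data.Nat.Properties using (_≟_)
open import Data.Sum using (_⊎_)
open import Data.Product using (_×_)
open import Relation.Binary.PropositionalEquality using (_≡_)
open import Relation.Nullary using (yes; no)

⌊_/_⌋ : (x q' : ℕ) → .{{NonZero q'}} → ℕ
⌊ x / q' ⌋ = x / q'

-- a + (-1)^e  for e ∈ {0,1} (e = 0 ↦ a + 1, e = 1 ↦ a - 1);
-- only used with a ≥ 1, so truncated subtraction is exact
shift : ℕ → ℕ → ℕ
shift a zero    = a + 1
shift a (suc _) = a ∸ 1

Interfacial : (q q' a : ℕ) → .{{NonZero q'}} → Set
Interfacial q q' a =
  (a ≡ 0) ⊎ (a ≡ q') ⊎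
  ((2 ≤ a) × (a ≤ q' ∸ 2) ×
   (⌊ (a + 1) * q / q' ⌋ ≡ ⌊ (a ∸ 1) * q / q' ⌋ + 1))

δ : (q q' a e : ℕ) → .{{NonZero q'}} → ℕ
δ q q' a e with ⌊ shift a e * q / q' ⌋ ≟ ⌊ a * q / q' ⌋
... | yes _ = 0
... | no  _ = 1

{-# OPTIONS --safe #-}
module Submission where

-- For 0 < x < p' the remainders of x p and x (p' − p) modulo p' are nonzero (p' is coprime
-- to p) and add up to a multiple of p', hence to exactly p'; so ⌊ x (p' − p) / p' ⌋ +
-- ⌊ x p / p' ⌋ = x − 1. Along 1 ≤ x < p' every unit step of x therefore raises exactly one of
-- the two floors by one: a jump of the first floor across [a − 1, a + 1] (interfaciality)
-- forces a jump of the second, and a plateau of the first on one side of a (δ = 0) becomes a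
-- plateau of the second on the other side.

open import Defs
open import Data.Nat using (ℕ; zero; suc; _+_; _*_; _∸_; _≤_; _<_; NonZero; z≤n; s≤s; s≤s⁻¹; >-nonZero)
open import Data.Nat.Coprimality using (Coprime; coprime-divisor)
import Data.Nat.Coprimality as Coprimality
open import Data.Nat.DivMod
open import Data.Nat.Divisibility using (_∣_; n∣m*n; m%n≡0⇒n∣m; ∣⇒≤)
open import Data.Nat.Properties
open import Data.Nat.Solver using (module +-*-Solver)
open import Data.Product using (_×_; _,_)
open import Data.Sum using (inj₁; inj₂)
open import Function.Bundles using (_⇔_; mk⇔; Equivalence)
open import Relation.Nullary using (yes; no; contradiction)
open import Relation.Binary.PropositionalEquality

open +-*-Solver using (solve; _:+_; _:*_; _:=_; con)
open Equivalence using (to; from)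
open ≡-Reasoning

+-distrib-/-carry : ∀ m n {d} .{{_ : NonZero d}} → d ≤ m % d + n % d →
                    (m + n) / d ≡ suc (m / d + n / d)
+-distrib-/-carry m n {d} d≤r = begin
  (m + n) / d                   ≡⟨ /-congˡ split ⟩
  (r ∸ d + suc q * d) / d       ≡⟨ +-distrib-/-∣ʳ (r ∸ d) (n∣m*n (suc q)) ⟩
  (r ∸ d) / d + suc q * d / d   ≡⟨ cong₂ _+_ (m<n⇒m/n≡0 r∸d<d) (m*n/n≡m (suc q) d) ⟩
  suc q                         ∎
  where
  r q : ℕ
  r = m % d + n % d
  q = m / d + n / d

  r∸d<d : r ∸ d < d
  r∸d<d = m<n+o⇒m∸n<o r d (+-mono-< (m%n<n m d) (m%n<n n d))

  split : m + n ≡ r ∸ d + suc q * d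
  split = begin
    m + n                                      ≡⟨ cong₂ _+_ (m≡m%n+[m/n]*n m d) (m≡m%n+[m/n]*n n d) ⟩
    (m % d + m / d * d) + (n % d + n / d * d)  ≡⟨ solve 5 (λ a b c e k → (a :+ b :* k) :+ (c :+ e :* k)
                                                                      := (a :+ c) :+ (b :+ e) :* k)
                                                          refl (m % d) (m / d) (n % d) (n / d) d ⟩
    r + q * d                                  ≡⟨ cong (_+ q * d) (m∸n+n≡m d≤r) ⟨
    r ∸ d + d + q * d                          ≡⟨ +-assoc (r ∸ d) d (q * d) ⟩
    r ∸ d + suc q * d                          ∎

floor-complement : ∀ {p p' x} .{{_ : NonZero p'}} → Coprime p p' → p ≤ p' → 1 ≤ x → x < p' →
                   suc (⌊ x * (p' ∸ p) / p' ⌋ + ⌊ x * p / p' ⌋) ≡ x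
floor-complement {p} {p'} {x} coprime p≤p' 1≤x x<p' = begin
  suc (u / p' + v / p')  ≡⟨ +-distrib-/-carry u v p'≤r ⟨
  (u + v) / p'           ≡⟨ /-congˡ u+v≡x*p' ⟩
  x * p' / p'            ≡⟨ m*n/n≡m x p' ⟩
  x                      ∎
  where
  u v : ℕ
  u = x * (p' ∸ p)
  v = x * p

  u+v≡x*p' : u + v ≡ x * p'
  u+v≡x*p' = trans (cong (_+ v) (*-distribˡ-∸ x p' p)) (m∸n+n≡m (*-monoʳ-≤ x p≤p'))

  v%p'≢0 : v % p' ≢ 0
  v%p'≢0 v%p'≡0 = <⇒≱ x<p' (∣⇒≤ {{>-nonZero 1≤x}} p'∣x)
    where
    p'∣x : p' ∣ x
    p'∣x = coprime-divisor (Coprimality.sym coprime)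
             (subst (p' ∣_) (*-comm x p) (m%n≡0⇒n∣m v p' v%p'≡0))

  p'∣r : p' ∣ u % p' + v % p'
  p'∣r = m%n≡0⇒n∣m _ p' (begin
    (u % p' + v % p') % p'  ≡⟨ %-distribˡ-+ u v p' ⟨
    (u + v) % p'            ≡⟨ %-congˡ u+v≡x*p' ⟩
    x * p' % p'             ≡⟨ m*n%n≡0 x p' ⟩
    0                       ∎)

  p'≤r : p' ≤ u % p' + v % p'
  p'≤r = ∣⇒≤ {{>-nonZero (≤-trans (n≢0⇒n>0 v%p'≢0) (m≤n+m (v % p') (u % p')))}} p'∣r

jump-complement : ∀ (F G : ℕ → ℕ) x y {j k} → suc (G x + F x) ≡ x → suc (G y + F y) ≡ j + k + x →
                  F y ≡ F x + j → G y ≡ G x + k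
jump-complement F G x y {j} {k} sum-x sum-y F-jump =
  +-cancelʳ-≡ (F x + j) (G y) (G x + k) (suc-injective (begin
    suc (G y + (F x + j))      ≡⟨ cong (λ n → suc (G y + n)) F-jump ⟨
    suc (G y + F y)            ≡⟨ sum-y ⟩
    j + k + x                  ≡⟨ cong (j + k +_) sum-x ⟨
    j + k + suc (G x + F x)    ≡⟨ solve 4 (λ g f j k → j :+ k :+ (con 1 :+ (g :+ f))
                                                    := con 1 :+ (g :+ k :+ (f :+ j)))
                                        refl (G x) (F x) j k ⟩
    suc (G x + k + (F x + j))  ∎))

δ≡0⇔ : ∀ q q' a e .{{_ : NonZero q'}} → δ q q' a e ≡ 0 ⇔ (⌊ shift a e * q / q' ⌋ ≡ ⌊ a * q / q' ⌋)
δ≡0⇔ q q' a e with ⌊ shift a e * q / q' ⌋ ≟ ⌊ a * q / q' ⌋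
... | yes same = mk⇔ (λ _ → same) (λ _ → refl)
... | no differ = mk⇔ (λ ()) (λ same → contradiction same differ)

interior-complement : ∀ {p p' a e} .{{_ : NonZero p'}} → Coprime p p' → p < p' → e ≤ 1 →
  (2 ≤ a) × (a ≤ p' ∸ 2) × (⌊ (a + 1) * p / p' ⌋ ≡ ⌊ (a ∸ 1) * p / p' ⌋ + 1) → δ p p' a e ≡ 0 →
  Interfacial (p' ∸ p) p' a × δ (p' ∸ p) p' a (1 ∸ e) ≡ 0
interior-complement {p} {p'} {suc m} {e} coprime p<p' e≤1 (2≤a , a≤p'∸2 , F-jump) δ≡0 =
  inj₂ (inj₂ (2≤a , a≤p'∸2 , G-jump)) , G-plateau e e≤1 δ≡0
  where
  F G : ℕ → ℕ
  F x = ⌊ x * p / p' ⌋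
  G x = ⌊ x * (p' ∸ p) / p' ⌋

  complement : ∀ {x} → 1 ≤ x → x < p' → suc (G x + F x) ≡ x
  complement = floor-complement coprime (<⇒≤ p<p')

  a+1<p' : suc m + 1 < p'
  a+1<p' = subst (_< p') (+-suc m 1)
    (m≤o∸n⇒m+n≤o (suc m) (≤-trans (≤-trans 2≤a a≤p'∸2) (m∸n≤m p' 2)) a≤p'∸2)

  a<p' : suc m < p'
  a<p' = ≤-<-trans (m≤m+n (suc m) 1) a+1<p'

  at-a-1 : suc (G m + F m) ≡ m
  at-a-1 = complement (s≤s⁻¹ 2≤a) (<-trans (n<1+n m) a<p')

  at-a : suc (G (suc m) + F (suc m)) ≡ suc m
  at-a = complement (s≤s z≤n) a<p'

  at-a+1 : suc (G (suc m + 1) + F (suc m + 1)) ≡ suc (suc m)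
  at-a+1 = trans (complement (s≤s z≤n) a+1<p') (+-comm (suc m) 1)

  G-jump : G (suc m + 1) ≡ G m + 1
  G-jump = jump-complement F G m (suc m + 1) at-a-1 at-a+1 F-jump

  G-plateau : ∀ e → e ≤ 1 → δ p p' (suc m) e ≡ 0 → δ (p' ∸ p) p' (suc m) (1 ∸ e) ≡ 0
  G-plateau zero _ δ≡0 = from (δ≡0⇔ (p' ∸ p) p' (suc m) 1) (sym (begin
    G (suc m)      ≡⟨ jump-complement F G m (suc m) at-a-1 at-a F-jump-left ⟩
    G m + 0        ≡⟨ +-identityʳ (G m) ⟩
    G m            ∎))
    where
    F-jump-left : F (suc m) ≡ F m + 1
    F-jump-left = trans (sym (to (δ≡0⇔ p p' (suc m) 0) δ≡0)) F-jump
  G-plateau (suc zero) _ δ≡0 = from (δ≡0⇔ (p' ∸ p) p' (suc m) 0) (begin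
    G (suc m + 1)  ≡⟨ jump-complement F G (suc m) (suc m + 1) at-a at-a+1 F-jump-right ⟩
    G (suc m) + 0  ≡⟨ +-identityʳ (G (suc m)) ⟩
    G (suc m)      ∎)
    where
    F-jump-right : F (suc m + 1) ≡ F (suc m) + 1
    F-jump-right = trans F-jump (cong (_+ 1) (to (δ≡0⇔ p p' (suc m) 1) δ≡0))
  G-plateau (suc (suc _)) (s≤s ())

lemmaC2 : (p p' a : ℕ) → .{{_ : NonZero p'}} → Coprime p p' → 1 ≤ p → p < p' → 1 ≤ a → a < p' →
    (⌊ a * (p' ∸ p) / p' ⌋ ≡ a ∸ 1 ∸ ⌊ a * p / p' ⌋)
    × ((e : ℕ) → e ≤ 1 → Interfacial p p' a → δ p p' a e ≡ 0 →
       Interfacial (p' ∸ p) p' a × δ (p' ∸ p) p' a (1 ∸ e) ≡ 0)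
lemmaC2 p p' a coprime _ p<p' 1≤a a<p' = closed-form , transfer
  where
  closed-form : ⌊ a * (p' ∸ p) / p' ⌋ ≡ a ∸ 1 ∸ ⌊ a * p / p' ⌋
  closed-form = sym (begin
    a ∸ 1 ∸ f  ≡⟨ cong (λ n → n ∸ 1 ∸ f) complement ⟨
    g + f ∸ f  ≡⟨ m+n∸n≡m g f ⟩
    g          ∎)
    where
    g f : ℕ
    g = ⌊ a * (p' ∸ p) / p' ⌋
    f = ⌊ a * p / p' ⌋

    complement : suc (g + f) ≡ a
    complement = floor-complement coprime (<⇒≤ p<p') 1≤a a<p'

  transfer : (e : ℕ) → e ≤ 1 → Interfacial p p' a → δ p p' a e ≡ 0 →
             Interfacial (p' ∸ p) p' a × δ (p' ∸ p) p' a (1 ∸ e) ≡ 0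
  transfer _ _   (inj₁ a≡0)             _   = contradiction (sym a≡0) (<⇒≢ 1≤a)
  transfer _ _   (inj₂ (inj₁ a≡p'))     _   = contradiction a≡p' (<⇒≢ a<p')
  transfer e e≤1 (inj₂ (inj₂ interior)) δ≡0 = interior-complement coprime p<p' e≤1 interior δ≡0
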